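{- Let $n\ge 0$ and let $\phi:\mathcal{D}_n\to\mathcal{K}_{n+1,n}$ be defined as follows. For $P\in\mathcal{D}_n$ with $k$ East steps (hence also $k$ North steps), label each $E$ step and each $N$ step of $P$ with the $y$-coordinate of its terminal point; let $x_i$ be the label of the $i$-th $N$ step and $y_i$ the label of the $i$-th $E$ step ($1\le i\le k$), and let $\phi(P)$ be the Kimberling path with vertex sequence $(0,0),(x_1,y_1),\dots,(x_k,y_k),(n+1,n)$. Then $\phi$ preserves the subdiagonal property: for every $P\in\mathcal{D}_n$, $P$ is subdiagonal if and only if $\phi(P)$ is subdiagonal.
   Context: $\mathcal{D}_n$ is the set of lattice paths from $(0,0)$ to $(n,n)$ with steps $E=(1,0)$, $N=(0,1)$, $D=(1,1)$ (central Delannoy paths). A Kimberling path ending at $(i,j)$ is a lattice path from $(0,0)$ to $(i,j)$ each of whose steps joins two lattice points and has finite nonnegative slope (positive $x$-increment, nonnegative $y$-increment, arbitrary length); it is determined by its vertex sequence of lattice points with strictly increasing $x$-coordinates and weakly increasing $y$-coordinates, the vertices other than the endpoints being its interior vertices. $\mathcal{K}_{n+1,n}$ is the set of Kimberling paths ending at $(n+1,n)$. A lattice path is subdiagonal if it lies weakly below the straight line joining its initial and terminal vertices; thus $P\in\mathcal{D}_n$ is subdiagonal iff every point of $P$ satisfies $y\le x$, and a path in $\mathcal{K}_{n+1,n}$ is subdiagonal iff every point of it satisfies $y\le \frac{n}{n+1}x$. -}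

module Defs where

open import Data.Nat using (ℕ; zero; suc; _+_; _*_; _∸_; _≤_; _<_)
open import Data.Product using (Σ; Σ-syntax; _×_; _,_; proj₁; proj₂)
open import Data.Sum using (_⊎_)
open import Data.List using (List; []; _∷_; _++_; [_]; zip)
open import Data.List.Membership.Propositional using (_∈_)
open import Data.List.Relation.Unary.Linked using (Linked)
open import Relation.Binary.PropositionalEquality using (_≡_)

Point : Set
Point = ℕ × ℕ

data Step : Set where
  E N D : Step

move : Step → Point → Point
move E (x , y) = (suc x , y)
move N (x , y) = (x , suc y)
move D (x , y) = (suc x , suc y)

walk : Point → List Step → List Point
walk p []      = []
walk p (s ∷ ss) = move s p ∷ walk (move s p) ss

vertices : List Step → List Point
vertices ss = (0 , 0) ∷ walk (0 , 0) ss

endpoint : Point → List Step → Point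
endpoint p []       = p
endpoint p (s ∷ ss) = endpoint (move s p) ss

Delannoy : ℕ → Set
Delannoy n = Σ (List Step) λ ss → endpoint (0 , 0) ss ≡ (n , n)

segments : List Point → List (Point × Point)
segments []            = []
segments (u ∷ [])      = []
segments (u ∷ v ∷ vs)  = (u , v) ∷ segments (v ∷ vs)

-- OnPath vs q X Y : the (rational) point (X/q, Y/q) lies on the polygonal
-- path with vertex sequence vs, i.e. it is a vertex, or it equals
-- (1 - p/q)·u + (p/q)·v for a segment (u,v) and 0 ≤ p ≤ q.
OnPath : List Point → ℕ → ℕ → ℕ → Set
OnPath vs q X Y =
  (Σ[ u ∈ Point ] (u ∈ vs × X ≡ q * proj₁ u × Y ≡ q * proj₂ u))
  ⊎ (Σ[ uv ∈ Point × Point ] Σ[ p ∈ ℕ ]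
       (uv ∈ segments vs × p ≤ q
        × X ≡ (q ∸ p) * proj₁ (proj₁ uv) + p * proj₁ (proj₂ uv)
        × Y ≡ (q ∸ p) * proj₂ (proj₁ uv) + p * proj₂ (proj₂ uv)))

SubdiagonalD : List Step → Set
SubdiagonalD ss = ∀ q X Y → 1 ≤ q → OnPath (vertices ss) q X Y → Y ≤ X

-- Kimberling path ending at (n+1,n), given by its list of interior vertices.
kimbVertices : ℕ → List Point → List Point
kimbVertices n vs = (0 , 0) ∷ vs ++ [ (suc n , n) ]

KStep : Point → Point → Set
KStep (a , b) (c , d) = a < c × b ≤ d

IsKimberling : ℕ → List Point → Set
IsKimberling n vs = Linked KStep (kimbVertices n vs)

SubdiagonalK : ℕ → List Point → Set
SubdiagonalK n vs =
  ∀ q X Y → 1 ≤ q → OnPath (kimbVertices n vs) q X Y → suc n * Y ≤ n * X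

nLabels : ℕ → List Step → List ℕ
nLabels y []       = []
nLabels y (E ∷ ss) = nLabels y ss
nLabels y (N ∷ ss) = suc y ∷ nLabels (suc y) ss
nLabels y (D ∷ ss) = nLabels (suc y) ss

eLabels : ℕ → List Step → List ℕ
eLabels y []       = []
eLabels y (E ∷ ss) = y ∷ eLabels y ss
eLabels y (N ∷ ss) = eLabels (suc y) ss
eLabels y (D ∷ ss) = eLabels (suc y) ss

φ : List Step → List Point
φ ss = zip (nLabels 0 ss) (eLabels 0 ss)

-- A half-plane through the origin is closed under positive combinations, so a polygonal
-- path lies in it iff its vertices do; both subdiagonality conditions thus become vertex
-- conditions.  The interior vertices (xᵢ, yᵢ) of φ(P) have 1 ≤ xᵢ and yᵢ ≤ n, where
-- (n+1)·yᵢ ≤ n·xᵢ is equivalent to yᵢ < xᵢ.  And P stays weakly below the diagonal iff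
-- its i-th N step comes after its i-th E step, i.e. iff the i-th E label is smaller than
-- the i-th N label.

module Submission where

open import Defs
open import Data.Nat using (ℕ)
open import Data.Product using (_×_; proj₁)
open import Function.Bundles using (_⇔_)

open import Data.Nat using (zero; suc; _+_; _*_; _∸_; _≤_; _<_; z≤n; s≤s)
open import Data.Nat.Properties
open import Algebra.Properties.CommutativeSemigroup *-commutativeSemigroup using (x∙yz≈y∙xz)
open import Data.Product using (_,_)
open import Data.Product.Relation.Binary.Pointwise.NonDependent using (Pointwise)
open import Data.Sum using (inj₁; inj₂)
open import Data.Empty using (⊥-elim)
open import Data.List using (List; []; _∷_; _++_; [_]; zip; length)
open import Data.List.Properties using (++-assoc; length-++)
open import Data.List.Relation.Unary.All as All using (All; []; _∷_)
open import Data.List.Relation.Unary.All.Properties using (++⁻ˡ; ∷ʳ⁺)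
open import Data.List.Membership.Propositional using (_∈_)
open import Data.List.Relation.Unary.Any using (here; there)
open import Data.List.Relation.Unary.Linked using (Linked; [-]; _∷_)
open import Function using (_∘_)
open import Function.Bundles using (mk⇔; Equivalence)
open import Function.Construct.Composition using (_⇔-∘_)
open import Function.Related.Propositional using (module EquationalReasoning)
open import Function.Construct.Symmetry using (⇔-sym)
open import Level using (0ℓ)
open import Relation.Binary using (Rel; Trans)
open import Relation.Binary.PropositionalEquality
  using (_≡_; refl; sym; trans; cong; subst; subst₂; module ≡-Reasoning)
open import Relation.Nullary using (¬_; yes; no)

open Equivalence using (to; from)

All-∷-⇔ : ∀ {A B : Set} {P : A → Set} {x xs} → P x → All P xs ⇔ B → All P (x ∷ xs) ⇔ B
All-∷-⇔ px xs⇔B = mk⇔ (to xs⇔B ∘ All.tail) ((px ∷_) ∘ from xs⇔B)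

All-∷-cong-⇔ : ∀ {A B : Set} {P : A → Set} {Q : B → Set} {x y xs ys} →
               P x → Q y → All P xs ⇔ All Q ys → All P (x ∷ xs) ⇔ All Q (y ∷ ys)
All-∷-cong-⇔ px qy xs⇔ys = All-∷-⇔ px (⇔-sym (All-∷-⇔ qy (⇔-sym xs⇔ys)))

All-zip : ∀ {A B : Set} {P : A → Set} {Q : B → Set} {xs ys} → All P xs → All Q ys →
          All (λ (x , y) → P x × Q y) (zip xs ys)
All-zip [] _ = []
All-zip (_ ∷ _) [] = []
All-zip (px ∷ pxs) (qy ∷ qys) = (px , qy) ∷ All-zip pxs qys

All-∷ʳ-⇔ : ∀ {A : Set} {P : A → Set} {x} xs → P x → All P (xs ++ [ x ]) ⇔ All P xs
All-∷ʳ-⇔ xs px = mk⇔ (++⁻ˡ xs) (λ pxs → ∷ʳ⁺ pxs px)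

All-⇔ : ∀ {A : Set} {P Q R : A → Set} {xs} →
        (∀ {x} → P x → Q x ⇔ R x) → All P xs → All Q xs ⇔ All R xs
All-⇔ Q⇔R [] = mk⇔ (λ _ → []) (λ _ → [])
All-⇔ Q⇔R (px ∷ pxs) = mk⇔
  (λ { (qx ∷ qxs) → to (Q⇔R px) qx ∷ to (All-⇔ Q⇔R pxs) qxs })
  (λ { (rx ∷ rxs) → from (Q⇔R px) rx ∷ from (All-⇔ Q⇔R pxs) rxs })

Below : ℕ → ℕ → Point → Set
Below a b (x , y) = a * y ≤ b * x

PathBelow : ℕ → ℕ → List Point → Set
PathBelow a b vs = ∀ q X Y → 1 ≤ q → OnPath vs q X Y → a * Y ≤ b * X

Below-origin : ∀ a b → Below a b (0 , 0)
Below-origin a b rewrite *-zeroʳ a = z≤n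

∈-segments⇒∈ : ∀ (vs : List Point) {u v} → (u , v) ∈ segments vs → u ∈ vs × v ∈ vs
∈-segments⇒∈ (w ∷ w′ ∷ ws) (here refl) = here refl , there (here refl)
∈-segments⇒∈ (w ∷ w′ ∷ ws) (there uv∈) =
  let u∈ , v∈ = ∈-segments⇒∈ (w′ ∷ ws) uv∈ in there u∈ , there v∈

Below-scale : ∀ a b c {x y} → Below a b (x , y) → Below a b (c * x , c * y)
Below-scale a b c {x} {y} ay≤bx = begin
  a * (c * y)  ≡⟨ x∙yz≈y∙xz a c y ⟩
  c * (a * y)  ≤⟨ *-monoʳ-≤ c ay≤bx ⟩
  c * (b * x)  ≡⟨ x∙yz≈y∙xz c b x ⟩
  b * (c * x)  ∎
  where open ≤-Reasoning

Below-+ : ∀ a b {x y x′ y′} → Below a b (x , y) → Below a b (x′ , y′) →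
          Below a b (x + x′ , y + y′)
Below-+ a b {x} {y} {x′} {y′} u≤ v≤ = begin
  a * (y + y′)      ≡⟨ *-distribˡ-+ a y y′ ⟩
  a * y + a * y′    ≤⟨ +-mono-≤ u≤ v≤ ⟩
  b * x + b * x′    ≡⟨ *-distribˡ-+ b x x′ ⟨
  b * (x + x′)      ∎
  where open ≤-Reasoning

PathBelow⇔All-Below : ∀ a b vs → PathBelow a b vs ⇔ All (Below a b) vs
PathBelow⇔All-Below a b vs = mk⇔ vertices-below polyline-below
  where
  vertices-below : PathBelow a b vs → All (Below a b) vs
  vertices-below below = All.tabulate λ {(x , y)} u∈ →
    subst₂ (λ Y X → a * Y ≤ b * X) (*-identityˡ y) (*-identityˡ x)
      (below 1 (1 * x) (1 * y) ≤-refl (inj₁ (_ , u∈ , refl , refl)))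

  polyline-below : All (Below a b) vs → PathBelow a b vs
  polyline-below all q _ _ _ (inj₁ (u , u∈ , refl , refl)) =
    Below-scale a b q (All.lookup all u∈)
  polyline-below all q _ _ _ (inj₂ ((u , v) , p , uv∈ , _ , refl , refl)) =
    let u∈ , v∈ = ∈-segments⇒∈ vs uv∈ in
    Below-+ a b (Below-scale a b (q ∸ p) (All.lookup all u∈))
                (Below-scale a b p (All.lookup all v∈))

Below-slope⇔< : ∀ n {x y} → 1 ≤ x → y ≤ n → Below (suc n) n (x , y) ⇔ y < x
Below-slope⇔< n {x} {y} 1≤x y≤n = mk⇔ below⇒< <⇒below
  where
  open ≤-Reasoning
  below⇒< : suc n * y ≤ n * x → y < x
  below⇒< below with x ≤? y
  ... | no x≰y = ≰⇒> x≰y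
  ... | yes x≤y = ⊥-elim (<-irrefl refl (begin-strict
    n * x      <⟨ +-monoˡ-≤ (n * x) 1≤x ⟩
    x + n * x  ≤⟨ *-monoʳ-≤ (suc n) x≤y ⟩
    suc n * y  ≤⟨ below ⟩
    n * x      ∎))
  <⇒below : y < x → suc n * y ≤ n * x
  <⇒below y<x = begin
    y + n * y  ≤⟨ +-monoˡ-≤ (n * y) y≤n ⟩
    n + n * y  ≡⟨ *-suc n y ⟨
    n * suc y  ≤⟨ *-monoʳ-≤ n y<x ⟩
    n * x      ∎

SubdiagonalK⇔All-Below : ∀ n vs → SubdiagonalK n vs ⇔ All (Below (suc n) n) vs
SubdiagonalK⇔All-Below n vs =
  All-∷-⇔ (Below-origin (suc n) n)
    (All-∷ʳ-⇔ vs (≤-reflexive (*-comm (suc n) n)))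
  ⇔-∘ PathBelow⇔All-Below (suc n) n (kimbVertices n vs)

Linked-lower-head : ∀ {A : Set} {R S : Rel A 0ℓ} {w z xs} → Trans S R R →
                    S w z → Linked R (z ∷ xs) → Linked R (w ∷ xs)
Linked-lower-head trans w∼z [-] = [-]
Linked-lower-head trans w∼z (z∼ ∷ linked) = trans w∼z z∼ ∷ linked

zip-Linked : ∀ {A B : Set} {R : Rel A 0ℓ} {S : Rel B 0ℓ} {a c : A} {b d : B}
             (as : List A) (bs : List B) → length as ≡ length bs →
             Linked R (a ∷ as ++ [ c ]) → Linked S (b ∷ bs ++ [ d ]) →
             Linked (Pointwise R S) ((a , b) ∷ zip as bs ++ [ (c , d) ])
zip-Linked [] [] _ (r ∷ _) (s ∷ _) = (r , s) ∷ [-]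
zip-Linked (_ ∷ as) (_ ∷ bs) eq (r ∷ rs) (s ∷ ss) =
  (r , s) ∷ zip-Linked as bs (suc-injective eq) rs ss

Subdiagonal StrictlySubdiagonal : Point → Set
Subdiagonal (x , y) = y ≤ x
StrictlySubdiagonal (x , y) = y < x

SubdiagonalD⇔All-Subdiagonal : ∀ ss → SubdiagonalD ss ⇔ All Subdiagonal (walk (0 , 0) ss)
SubdiagonalD⇔All-Subdiagonal ss = begin
  SubdiagonalD ss                    ∼⟨ mk⇔ (λ sd q X Y q≥1 o → from one-one (sd q X Y q≥1 o))
                                            (λ pb q X Y q≥1 o → to one-one (pb q X Y q≥1 o)) ⟩
  PathBelow 1 1 (vertices ss)        ∼⟨ PathBelow⇔All-Below 1 1 (vertices ss) ⟩
  All (Below 1 1) (vertices ss)      ∼⟨ All-∷-⇔ z≤n (mk⇔ (All.map (to one-one)) (All.map (from one-one))) ⟩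
  All Subdiagonal (walk (0 , 0) ss)  ∎
  where
  open EquationalReasoning
  one-one : ∀ {x y} → 1 * y ≤ 1 * x ⇔ y ≤ x
  one-one {x} {y} = mk⇔ (subst₂ _≤_ (*-identityˡ y) (*-identityˡ x))
                        (subst₂ _≤_ (sym (*-identityˡ y)) (sym (*-identityˡ x)))

m≡n+o⇒n≤m : ∀ {m n} o → m ≡ n + o → n ≤ m
m≡n+o⇒n≤m {n = n} o refl = m≤m+n n o

-- A path strictly above the diagonal that ends on it still takes an E step, at height ≥ y.
above-diagonal⇒¬E-label< : ∀ ss {x y z p} (ns : List ℕ) → x < y → z ≤ y →
  endpoint (x , y) ss ≡ (p , p) → ¬ All StrictlySubdiagonal (zip (z ∷ ns) (eLabels y ss))
above-diagonal⇒¬E-label< [] ns x<y _ refl _ = <-irrefl refl x<y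
above-diagonal⇒¬E-label< (E ∷ ss) ns _ z≤y _ (y<z ∷ _) = <-irrefl refl (<-≤-trans y<z z≤y)
above-diagonal⇒¬E-label< (N ∷ ss) ns x<y z≤y =
  above-diagonal⇒¬E-label< ss ns (m≤n⇒m≤1+n x<y) (m≤n⇒m≤1+n z≤y)
above-diagonal⇒¬E-label< (D ∷ ss) ns x<y z≤y =
  above-diagonal⇒¬E-label< ss ns (s≤s x<y) (m≤n⇒m≤1+n z≤y)

-- pending is the queue of labels of the E steps not yet matched by an N step.
All-Subdiagonal⇔labels-interleave :
  ∀ ss {x h p} (pending : List ℕ) → x ≡ h + length pending → All (_≤ h) pending →
  endpoint (x , h) ss ≡ (p , p) →
  All Subdiagonal (walk (x , h) ss)
    ⇔ All StrictlySubdiagonal (zip (nLabels h ss) (pending ++ eLabels h ss))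
All-Subdiagonal⇔labels-interleave [] _ _ _ _ = mk⇔ (λ _ → []) (λ _ → [])
All-Subdiagonal⇔labels-interleave (E ∷ ss) {x} {h} pending x≡ pending≤h end =
  All-∷-⇔ (m≤n⇒m≤1+n (m≡n+o⇒n≤m (length pending) x≡))
    (subst (λ es → _ ⇔ All StrictlySubdiagonal (zip (nLabels h ss) es))
      (++-assoc pending [ h ] (eLabels h ss))
      (All-Subdiagonal⇔labels-interleave ss (pending ++ [ h ]) x+1≡ (∷ʳ⁺ pending≤h ≤-refl) end))
  where
  x+1≡ : suc x ≡ h + length (pending ++ [ h ])
  x+1≡ = begin
    suc x                         ≡⟨ cong suc x≡ ⟩
    suc (h + length pending)      ≡⟨ +-suc h (length pending) ⟨
    h + suc (length pending)      ≡⟨ cong (h +_) (+-comm 1 (length pending)) ⟩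
    h + (length pending + 1)      ≡⟨ cong (h +_) (length-++ pending) ⟨
    h + length (pending ++ [ h ]) ∎
    where open ≡-Reasoning
All-Subdiagonal⇔labels-interleave (D ∷ ss) {x} {h} pending x≡ pending≤h end =
  All-∷-⇔ (s≤s (m≡n+o⇒n≤m (length pending) x≡))
    (All-Subdiagonal⇔labels-interleave ss pending (cong suc x≡)
      (All.map m≤n⇒m≤1+n pending≤h) end)
All-Subdiagonal⇔labels-interleave (N ∷ ss) {x} {h} [] x≡ _ end =
  mk⇔ (λ { (h<x ∷ _) → ⊥-elim (<-irrefl (sym x≡h) (<-≤-trans (n<1+n h) h<x)) })
      (⊥-elim ∘ above-diagonal⇒¬E-label< ss _ (s≤s (≤-reflexive x≡h)) ≤-refl end)
  where
  x≡h : x ≡ h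
  x≡h = trans x≡ (+-identityʳ h)
All-Subdiagonal⇔labels-interleave (N ∷ ss) {x} {h} (e ∷ pending) x≡ (e≤h ∷ pending≤h) end =
  All-∷-cong-⇔ (m≡n+o⇒n≤m (length pending) x≡′) (s≤s e≤h)
    (All-Subdiagonal⇔labels-interleave ss pending x≡′ (All.map m≤n⇒m≤1+n pending≤h) end)
  where
  x≡′ : x ≡ suc h + length pending
  x≡′ = trans x≡ (+-suc h (length pending))

nLabels-above : ∀ y ss → All (y <_) (nLabels y ss)
nLabels-above y [] = []
nLabels-above y (E ∷ ss) = nLabels-above y ss
nLabels-above y (N ∷ ss) = n<1+n y ∷ All.map <⇒≤ (nLabels-above (suc y) ss)
nLabels-above y (D ∷ ss) = All.map <⇒≤ (nLabels-above (suc y) ss)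

height≤endpoint-height : ∀ ss {x y p q} → endpoint (x , y) ss ≡ (p , q) → y ≤ q
height≤endpoint-height [] refl = ≤-refl
height≤endpoint-height (E ∷ ss) end = height≤endpoint-height ss end
height≤endpoint-height (N ∷ ss) end = <⇒≤ (height≤endpoint-height ss end)
height≤endpoint-height (D ∷ ss) end = <⇒≤ (height≤endpoint-height ss end)

eLabels-below : ∀ ss {x y p q} → endpoint (x , y) ss ≡ (p , q) → All (_≤ q) (eLabels y ss)
eLabels-below [] end = []
eLabels-below (E ∷ ss) end = height≤endpoint-height ss end ∷ eLabels-below ss end
eLabels-below (N ∷ ss) end = eLabels-below ss end
eLabels-below (D ∷ ss) end = eLabels-below ss end

-- p = x + #E + #D and q = y + #N + #D.
labels-balance : ∀ ss {x y p q} → endpoint (x , y) ss ≡ (p , q) →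
                 length (eLabels y ss) + (x + q) ≡ length (nLabels y ss) + (y + p)
labels-balance [] {x} {y} refl = cong (0 +_) (+-comm x y)
labels-balance (E ∷ ss) end = trans (sym (+-suc _ _)) (labels-balance ss end)
labels-balance (N ∷ ss) end = trans (labels-balance ss end) (+-suc _ _)
labels-balance (D ∷ ss) end =
  suc-injective (trans (sym (+-suc _ _)) (trans (labels-balance ss end) (+-suc _ _)))

nLabels-increasing : ∀ ss {x y p q} → endpoint (x , y) ss ≡ (p , q) →
                     Linked _<_ (y ∷ nLabels y ss ++ [ suc q ])
nLabels-increasing [] refl = ≤-refl ∷ [-]
nLabels-increasing (E ∷ ss) end = nLabels-increasing ss end
nLabels-increasing (N ∷ ss) end = ≤-refl ∷ nLabels-increasing ss end
nLabels-increasing (D ∷ ss) {y = y} end =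
  Linked-lower-head ≤-<-trans (n≤1+n y) (nLabels-increasing ss end)

eLabels-nondecreasing : ∀ ss {x y p q} → endpoint (x , y) ss ≡ (p , q) →
                        Linked _≤_ (y ∷ eLabels y ss ++ [ q ])
eLabels-nondecreasing [] refl = ≤-refl ∷ [-]
eLabels-nondecreasing (E ∷ ss) end = ≤-refl ∷ eLabels-nondecreasing ss end
eLabels-nondecreasing (N ∷ ss) {y = y} end =
  Linked-lower-head ≤-trans (n≤1+n y) (eLabels-nondecreasing ss end)
eLabels-nondecreasing (D ∷ ss) {y = y} end =
  Linked-lower-head ≤-trans (n≤1+n y) (eLabels-nondecreasing ss end)

proposition1 : (n : ℕ) (P : Delannoy n) →
    IsKimberling n (φ (proj₁ P))
    × (SubdiagonalD (proj₁ P) ⇔ SubdiagonalK n (φ (proj₁ P)))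
proposition1 n (ss , end) = kimberling , subdiagonal⇔
  where
  ns = nLabels 0 ss
  es = eLabels 0 ss

  same-length : length ns ≡ length es
  same-length = sym (+-cancelʳ-≡ n _ _ (labels-balance ss end))

  kimberling : IsKimberling n (φ ss)
  kimberling = zip-Linked ns es same-length
    (nLabels-increasing ss end) (eLabels-nondecreasing ss end)

  subdiagonal⇔ : SubdiagonalD ss ⇔ SubdiagonalK n (φ ss)
  subdiagonal⇔ = begin
    SubdiagonalD ss                    ∼⟨ SubdiagonalD⇔All-Subdiagonal ss ⟩
    All Subdiagonal (walk (0 , 0) ss)  ∼⟨ All-Subdiagonal⇔labels-interleave ss [] refl [] end ⟩
    All StrictlySubdiagonal (φ ss)     ∼⟨ ⇔-sym (All-⇔ (λ (1≤x , y≤n) → Below-slope⇔< n 1≤x y≤n)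
                                                   (All-zip (nLabels-above 0 ss) (eLabels-below ss end))) ⟩
    All (Below (suc n) n) (φ ss)       ∼⟨ ⇔-sym (SubdiagonalK⇔All-Below n (φ ss)) ⟩
    SubdiagonalK n (φ ss)              ∎
    where open EquationalReasoning
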